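{- Consider an instance of the energy-constrained scheduling problem with communication delays (defined in the context) with $m \ge n$ processors and a given $\rho \ge 1$. For every $\mu \ge 0$, there exist $t_j, d_j$ ($j\in J$) and $x_{ij}$ (edges $i\to j$) such that $(\mu, t, d, x)$ is a feasible solution of program $P_4$ if and only if there exists a feasible schedule on $m$ processors that uses no preemption, migration, or recomputation, has makespan $\mu$, and satisfies $c_{ij} \le d_k/\rho$ for every edge $i \to j$ of $G$ and every task $k$.
   Context: Problem (with communication delays): a finite set $J$ of $n$ tasks; $m$ identical processors; a directed acyclic graph $G$ on $J$; a delay $c_{ij} \ge 0$ for each edge $i \to j$; for each task $j$ a convex, non-increasing energy function $e_j:[0,\infty)\to[0,\infty)$; an energy bound $E\ge 0$. A schedule without preemption, migration, or recomputation runs each task $j$ exactly once, in a single interval $[t_j, t_j + d_j]$ on a single processor $p_j$. It is feasible if: for every edge $i\to j$, $t_j \ge t_i + d_i$, and moreover $t_j \ge t_i + d_i + c_{ij}$ if $p_i \ne p_j$; each processor runs at most one task at any time; and $\sum_j e_j(d_j) \le E$. The makespan is $\max_j (t_j + d_j)$. Program $P_4$: minimize $\mu$ over $\mu, t_j, d_j \ge 0$ and $x_{ij}$ (one per edge) subject to: $t_j \ge t_i + d_i + (1 - x_{ij})c_{ij}$ for all edges $i \to j$; $\sum_{j: i\to j} x_{ij} \le 1$ for all $i$; $\sum_{i: i \to j} x_{ij} \le 1$ for all $j$; $\mu \ge t_j + d_j$ for all $j$; $x_{ij} \in \{0,1\}$; $\sum_j e_j(d_j) \le E$; $c_{ij}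 \le d_k/\rho$ for all edges $i\to j$ and all tasks $k$; $\mu \ge \frac1m \sum_j d_j$. -}

module Defs where

open import Level using (0ℓ)
open import Data.Nat as ℕ using (ℕ; zero; suc)
open import Data.Fin using (Fin; zero; suc)
open import Data.Bool using (Bool; true; false; T)
open import Data.Product using (Σ; ∃; _×_; _,_)
open import Data.Sum using (_⊎_)
open import Relation.Nullary using (¬_)
open import Relation.Binary.PropositionalEquality using (_≡_; _≢_)
open import Relation.Binary.Structures using (IsTotalOrder)
open import Relation.Binary.Construct.Closure.Transitive using (TransClosure)
open import Algebra.Structures using (IsCommutativeRing)

-- An ordered field (the real numbers are the intended instance).

record OrderedField : Set₁ where
  infixl 6 _+_ _-_
  infixl 7 _*_
  infix 4 _≤_
  field
    Carrier : Set
    _+_ _*_ : Carrier → Carrier → Carrier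
    -_      : Carrier → Carrier
    0# 1#   : Carrier
    _≤_     : Carrier → Carrier → Set
    isCommutativeRing : IsCommutativeRing _≡_ _+_ _*_ -_ 0# 1#
    0≢1     : 0# ≢ 1#
    inverse : ∀ x → x ≢ 0# → Σ Carrier (λ y → x * y ≡ 1#)
    isTotalOrder : IsTotalOrder _≡_ _≤_
    +-mono-≤ : ∀ {x y} z → x ≤ y → x + z ≤ y + z
    *-nonneg : ∀ {x y} → 0# ≤ x → 0# ≤ y → 0# ≤ x * y

  _-_ : Carrier → Carrier → Carrier
  x - y = x + (- y)

  ofℕ : ℕ → Carrier
  ofℕ zero    = 0#
  ofℕ (suc k) = 1# + ofℕ k

  ∑ : ∀ {n} → (Fin n → Carrier) → Carrier
  ∑ {zero}  f = 0#
  ∑ {suc n} f = f zero + ∑ (λ i → f (suc i))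

count : ∀ {n} → (Fin n → Bool) → ℕ
count {zero}  f = zero
count {suc n} f with f zero
... | true  = suc (count (λ i → f (suc i)))
... | false = count (λ i → f (suc i))

_∧_ : Bool → Bool → Bool
true  ∧ b = b
false ∧ _ = false

module _ (F : OrderedField) where
  open OrderedField F

  ConvexOnNonneg : (Carrier → Carrier) → Set
  ConvexOnNonneg e = ∀ x y λ' → 0# ≤ x → 0# ≤ y → 0# ≤ λ' → λ' ≤ 1# →
    e (λ' * x + (1# - λ') * y) ≤ λ' * e x + (1# - λ') * e y

  NonIncreasingOnNonneg : (Carrier → Carrier) → Set
  NonIncreasingOnNonneg e = ∀ x y → 0# ≤ x → x ≤ y → e y ≤ e x

  NonnegOnNonneg : (Carrier → Carrier) → Set
  NonnegOnNonneg e = ∀ x → 0# ≤ x → 0# ≤ e x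

  -- An instance: n tasks (Fin n), m processors, DAG given by adjacency
  -- `edge`, delays c (relevant only on edges), energy functions, bound E.
  record Instance (n m : ℕ) : Set where
    field
      edge    : Fin n → Fin n → Bool
      acyclic : ∀ i → ¬ TransClosure (λ a b → T (edge a b)) i i
      c       : Fin n → Fin n → Carrier
      c-nonneg : ∀ i j → T (edge i j) → 0# ≤ c i j
      e       : Fin n → Carrier → Carrier
      e-nonneg : ∀ j → NonnegOnNonneg (e j)
      e-convex : ∀ j → ConvexOnNonneg (e j)
      e-nonincreasing : ∀ j → NonIncreasingOnNonneg (e j)
      E       : Carrier
      E-nonneg : 0# ≤ E

  module _ {n m : ℕ} (I : Instance n m) (ρ : Carrier) where
    open Instance I

    -- the delay condition c_ij ≤ d_k / ρ, written (ρ > 0) as ρ·c_ij ≤ d_k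
    DelayCond : (Fin n → Carrier) → Set
    DelayCond d = ∀ i j k → T (edge i j) → ρ * c i j ≤ d k

    -- Feasible solution (μ, t, d, x) of program P₄; x_ij ∈ {0,1} as Bool
    P4Feasible : Carrier → (Fin n → Carrier) → (Fin n → Carrier) →
                 (Fin n → Fin n → Bool) → Set
    P4Feasible μ t d x =
        (0# ≤ μ)
      × (∀ j → 0# ≤ t j)
      × (∀ j → 0# ≤ d j)
      × (∀ i j → T (edge i j) →
           t i + d i + (if x i j then 0# else c i j) ≤ t j)
      × (∀ i → count (λ j → edge i j ∧ x i j) ℕ.≤ 1)
      × (∀ j → count (λ i → edge i j ∧ x i j) ℕ.≤ 1)
      × (∀ j → t j + d j ≤ μ)
      × (∑ (λ j → e j (d j)) ≤ E)
      × DelayCond d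
      × (∑ d ≤ ofℕ m * μ)        -- μ ≥ (1/m) Σ_j d_j, multiplied by m
      where
        if_then_else_ : {A : Set} → Bool → A → A → A
        if true  then a else _ = a
        if false then _ else b = b

    -- A schedule without preemption/migration/recomputation:
    -- task j runs once in [t j, t j + d j] on processor p j.
    record Schedule : Set where
      field
        t : Fin n → Carrier
        d : Fin n → Carrier
        p : Fin n → Fin m

    module _ (S : Schedule) where
      open Schedule S

      Feasible : Set
      Feasible =
          (∀ j → 0# ≤ t j)
        × (∀ j → 0# ≤ d j)
        × (∀ i j → T (edge i j) → t i + d i ≤ t j)
        × (∀ i j → T (edge i j) → p i ≢ p j → t i + d i + c i j ≤ t j)
        × (∀ j k → j ≢ k → p j ≡ p k → (t j + d j ≤ t k) ⊎ (t k + d k ≤ t j))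
        × (∑ (λ j → e j (d j)) ≤ E)

      HasMakespan : Carrier → Set
      HasMakespan μ = (∀ j → t j + d j ≤ μ) × ∃ (λ j → t j + d j ≡ μ)

module Submission where

-- (P₄ ⇒ schedule.)  The selected edges x_ij = 1 have in- and out-degree at
-- most one and lie in the acyclic graph G, so they split the tasks into
-- disjoint chains.  Every chain gets its own processor (there are at most
-- n ≤ m chains), named after the chain's first task; tasks of a chain run in
-- chain order, and an edge between different processors is unselected, so
-- P₄ already charges its delay.  Shifting all start times right by
-- μ - max_j (t_j + d_j) makes the makespan exactly μ.
--
-- (Schedule ⇒ P₄.)  Select i → j when, on their common processor, j is the
-- earliest-starting successor of i and i the latest-finishing predecessor
-- of j; this bounds the degrees by one.  An unselected edge inside one
-- processor is separated by another task k of that processor, of length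
-- d_k ≥ ρ·c_ij ≥ c_ij, which pays for the delay.  Finally
-- Σ_j d_j ≤ n·μ ≤ m·μ.

open import Level using (0ℓ)
open import Defs
open import Data.Nat using (ℕ; zero; suc; z≤n; s≤s; s≤s⁻¹)
import Data.Nat.Properties as ℕP
open import Data.Fin using (Fin; zero; suc; toℕ; inject≤; fromℕ<; _≟_)
import Data.Fin.Properties as FinP
open import Data.Bool using (Bool; true; false; T)
open import Data.Product using (Σ; ∃; _×_; _,_; proj₁; proj₂)
open import Data.Sum using (_⊎_; inj₁; inj₂)
import Data.Sum as Sum
open import Data.Empty using (⊥-elim)
open import Data.Unit using (tt)
open import Function using (flip; _$_; _∘_)
open import Relation.Nullary using (¬_; yes; no; Dec)
open import Relation.Nullary.Decidable using (T?; isYes; toWitness; fromWitness)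
open import Relation.Binary.PropositionalEquality
open import Relation.Binary.Structures using (IsTotalOrder)
open import Relation.Binary.Construct.Closure.Transitive
  using (TransClosure; [_]; _∷_; map; equivalent)
open import Relation.Binary.Construct.Closure.ReflexiveTransitive using (Star; ε; _◅_)
open import Algebra.Structures using (IsCommutativeRing)
open import Algebra.Bundles using (Ring)
open import Function.Bundles using (_⇔_; mk⇔; Equivalence)

∧-elimˡ : ∀ {a b} → T (a ∧ b) → T a
∧-elimˡ {true} _ = tt

∧-elimʳ : ∀ {a b} → T (a ∧ b) → T b
∧-elimʳ {true} q = q

∧-intro : ∀ {a b} → T a → T b → T (a ∧ b)
∧-intro {true} _ q = q

∧-false : ∀ a {b} → ¬ T (a ∧ b) → ¬ T a ⊎ ¬ T b
∧-false true  ¬b = inj₂ ¬b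
∧-false false _  = inj₁ λ ()

AtMostOne : ∀ {n} → (Fin n → Bool) → Set
AtMostOne f = ∀ a b → T (f a) → T (f b) → a ≡ b

count-zero⁺ : ∀ {n} (f : Fin n → Bool) → (∀ i → ¬ T (f i)) → count f ≡ 0
count-zero⁺ {zero}  f none = refl
count-zero⁺ {suc n} f none with f zero in f₀
... | true  = ⊥-elim (none zero (subst T (sym f₀) tt))
... | false = count-zero⁺ (λ i → f (suc i)) (λ i → none (suc i))

count-zero⁻ : ∀ {n} (f : Fin n → Bool) → count f ≡ 0 → ∀ i → ¬ T (f i)
count-zero⁻ {suc n} f c i with f zero in f₀
count-zero⁻ {suc n} f () i       | true
count-zero⁻ {suc n} f c zero     | false = subst T f₀
count-zero⁻ {suc n} f c (suc i)  | false = count-zero⁻ (λ i → f (suc i)) c i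

count-tail≤ : ∀ {n} (f : Fin (suc n) → Bool) → count (λ i → f (suc i)) Data.Nat.≤ count f
count-tail≤ f with f zero
... | true  = ℕP.n≤1+n _
... | false = ℕP.≤-refl

count≤1-first : ∀ {n} (f : Fin (suc n) → Bool) → T (f zero) → count f Data.Nat.≤ 1 →
                ∀ i → ¬ T (f (suc i))
count≤1-first f f₀ c with f zero
... | true  = count-zero⁻ (λ i → f (suc i)) (ℕP.n≤0⇒n≡0 (s≤s⁻¹ c))
... | false = ⊥-elim f₀

count≤1⇒AtMostOne : ∀ {n} (f : Fin n → Bool) → count f Data.Nat.≤ 1 → AtMostOne f
count≤1⇒AtMostOne f c zero    zero    _  _  = refl
count≤1⇒AtMostOne f c zero    (suc b) fa fb = ⊥-elim (count≤1-first f fa c b fb)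
count≤1⇒AtMostOne f c (suc a) zero    fa fb = ⊥-elim (count≤1-first f fb c a fa)
count≤1⇒AtMostOne f c (suc a) (suc b) fa fb =
  cong suc (count≤1⇒AtMostOne (λ i → f (suc i)) (ℕP.≤-trans (count-tail≤ f) c) a b fa fb)

AtMostOne⇒count≤1 : ∀ {n} (f : Fin n → Bool) → AtMostOne f → count f Data.Nat.≤ 1
AtMostOne⇒count≤1 {zero}  f once = z≤n
AtMostOne⇒count≤1 {suc n} f once with f zero in f₀
... | true  = s≤s (ℕP.≤-reflexive (count-zero⁺ (λ i → f (suc i))
                λ i fi → FinP.0≢1+n (once zero (suc i) (subst T (sym f₀) tt) fi)))
... | false = AtMostOne⇒count≤1 (λ i → f (suc i))
                λ a b fa fb → FinP.suc-injective (once (suc a) (suc b) fa fb)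

module Extremum {C : Set} (_≼_ : C → C → Set)
                (≼-total : ∀ a b → (a ≼ b) ⊎ (b ≼ a))
                (≼-trans : ∀ {a b c} → a ≼ b → b ≼ c → a ≼ c) where

  ≼-refl : ∀ a → a ≼ a
  ≼-refl a = Sum.[ (λ p → p) , (λ p → p) ] (≼-total a a)

  Least : ∀ {n} → (Fin n → Bool) → (Fin n → C) → Fin n → Set
  Least f key k = T (f k) × (∀ j → T (f j) → key k ≼ key j)

  Search : ∀ {n} → (Fin n → Bool) → (Fin n → C) → Set
  Search f key = (∀ j → ¬ T (f j)) ⊎ ∃ (Least f key)

  least : ∀ {n} (f : Fin n → Bool) (key : Fin n → C) → Search f key
  least {zero}  f key = inj₁ λ ()
  least {suc n} f key with least (λ i → f (suc i)) (λ i → key (suc i)) | f zero in f₀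
  ... | inj₁ none | false = inj₁ λ { zero p → subst T f₀ p ; (suc j) p → none j p }
  ... | inj₂ (k , fk , kmin) | false =
    inj₂ (suc k , fk , λ { zero p → ⊥-elim (subst T f₀ p) ; (suc j) p → kmin j p })
  ... | inj₁ none | true =
    inj₂ (zero , subst T (sym f₀) tt , λ { zero _ → ≼-refl (key zero) ; (suc j) p → ⊥-elim (none j p) })
  ... | inj₂ (k , fk , kmin) | true with ≼-total (key zero) (key (suc k))
  ...   | inj₁ z≼k = inj₂ (zero , subst T (sym f₀) tt ,
                       λ { zero _ → ≼-refl (key zero) ; (suc j) p → ≼-trans z≼k (kmin j p) })
  ...   | inj₂ k≼z = inj₂ (suc k , fk , λ { zero _ → k≼z ; (suc j) p → kmin j p })

  chosen : ∀ {n} {f : Fin n → Bool} {key : Fin n → C} → Search f key → Fin n → Bool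
  chosen (inj₁ _)       j = false
  chosen (inj₂ (k , _)) j = isYes (k ≟ j)

  chosen-once : ∀ {n} {f : Fin n → Bool} {key : Fin n → C} (s : Search f key) →
                AtMostOne (chosen s)
  chosen-once (inj₂ (k , _)) a b ka kb = trans (sym (toWitness ka)) (toWitness kb)

  not-chosen : ∀ {n} {f : Fin n → Bool} {key : Fin n → C} (s : Search f key) {j} →
               T (f j) → ¬ T (chosen s j) → ∃ λ k → k ≢ j × T (f k) × key k ≼ key j
  not-chosen (inj₁ none) fj _ = ⊥-elim (none _ fj)
  not-chosen (inj₂ (k , fk , kmin)) {j} fj ¬kj =
    k , (λ k≡j → ¬kj (fromWitness k≡j)) , fk , kmin j fj

module OrderedFieldFacts (F : OrderedField) where
  open OrderedField F
  open IsCommutativeRing isCommutativeRing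
    using (+-comm; +-assoc; +-identityˡ; +-identityʳ; -‿inverseʳ; -‿inverseˡ; distribʳ; *-identityˡ; zeroˡ)
  open IsTotalOrder isTotalOrder public using (total)
    renaming (refl to ≤-refl; trans to ≤-trans; reflexive to ≤-reflexive)
  open ≡-Reasoning

  private
    ring : Ring 0ℓ 0ℓ
    ring = record { isRing = IsCommutativeRing.isRing isCommutativeRing }
  open import Algebra.Properties.Ring ring using (-1*x≈-x)

  +-monoʳ-≤ : ∀ z {x y} → x ≤ y → z + x ≤ z + y
  +-monoʳ-≤ z {x} {y} x≤y = subst₂ _≤_ (+-comm x z) (+-comm y z) (+-mono-≤ z x≤y)

  +-mono : ∀ {a b c d} → a ≤ b → c ≤ d → a + c ≤ b + d
  +-mono {b = b} {c} a≤b c≤d = ≤-trans (+-mono-≤ c a≤b) (+-monoʳ-≤ b c≤d)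

  x≤x+y : ∀ x {y} → 0# ≤ y → x ≤ x + y
  x≤x+y x {y} 0≤y = subst₂ _≤_ (+-identityʳ x) refl (+-monoʳ-≤ x 0≤y)

  y≤x+y : ∀ {x} y → 0# ≤ x → y ≤ x + y
  y≤x+y {x} y 0≤x = subst₂ _≤_ (+-identityˡ y) refl (+-mono-≤ y 0≤x)

  +-nonneg : ∀ {a b} → 0# ≤ a → 0# ≤ b → 0# ≤ a + b
  +-nonneg 0≤a 0≤b = subst (_≤ _) (+-identityʳ 0#) (+-mono 0≤a 0≤b)

  ≤⇒0≤- : ∀ {a b} → a ≤ b → 0# ≤ b - a
  ≤⇒0≤- {a} a≤b = subst (_≤ _) (-‿inverseʳ a) (+-mono-≤ (- a) a≤b)

  x+[y-x]≡y : ∀ x y → x + (y - x) ≡ y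
  x+[y-x]≡y x y = begin
    x + (y + - x)   ≡⟨ cong (x +_) (+-comm y (- x)) ⟩
    x + (- x + y)   ≡⟨ +-assoc x (- x) y ⟨
    (x + - x) + y   ≡⟨ cong (_+ y) (-‿inverseʳ x) ⟩
    0# + y          ≡⟨ +-identityˡ y ⟩
    y               ∎

  +-swapʳ : ∀ a b c → (a + b) + c ≡ (a + c) + b
  +-swapʳ a b c = begin
    (a + b) + c   ≡⟨ +-assoc a b c ⟩
    a + (b + c)   ≡⟨ cong (a +_) (+-comm b c) ⟩
    a + (c + b)   ≡⟨ +-assoc a c b ⟨
    (a + c) + b   ∎

  shift-≤ : ∀ {a x b} s → a + x ≤ b → (a + s) + x ≤ b + s
  shift-≤ {a} {x} {b} s a+x≤b = subst (_≤ b + s) (sym (+-swapʳ a s x)) (+-mono-≤ s a+x≤b)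

  shift-≤₂ : ∀ {a x y b} s → (a + x) + y ≤ b → ((a + s) + x) + y ≤ b + s
  shift-≤₂ {a} {x} {y} {b} s a+x+y≤b =
    subst (_≤ b + s) (sym (trans (cong (_+ y) (+-swapʳ a s x)) (+-swapʳ (a + x) s y)))
          (+-mono-≤ s a+x+y≤b)

  ≤ρ* : ∀ {c ρ} → 0# ≤ c → 1# ≤ ρ → c ≤ ρ * c
  ≤ρ* {c} {ρ} 0≤c 1≤ρ =
    subst₂ _≤_ (+-identityˡ c) split (+-mono-≤ c (*-nonneg (≤⇒0≤- 1≤ρ) 0≤c))
    where
    split : (ρ - 1#) * c + c ≡ ρ * c
    split = begin
      (ρ + - 1#) * c + c         ≡⟨ cong (_+ c) (distribʳ c ρ (- 1#)) ⟩
      (ρ * c + - 1# * c) + c     ≡⟨ +-assoc (ρ * c) (- 1# * c) c ⟩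
      ρ * c + (- 1# * c + c)     ≡⟨ cong (λ z → ρ * c + (z + c)) (-1*x≈-x c) ⟩
      ρ * c + (- c + c)          ≡⟨ cong (ρ * c +_) (-‿inverseˡ c) ⟩
      ρ * c + 0#                 ≡⟨ +-identityʳ (ρ * c) ⟩
      ρ * c                      ∎

  ofℕ-suc-* : ∀ k μ → ofℕ (suc k) * μ ≡ μ + ofℕ k * μ
  ofℕ-suc-* k μ = begin
    (1# + ofℕ k) * μ      ≡⟨ distribʳ μ 1# (ofℕ k) ⟩
    1# * μ + ofℕ k * μ    ≡⟨ cong (_+ ofℕ k * μ) (*-identityˡ μ) ⟩
    μ + ofℕ k * μ         ∎

  ofℕ-*-mono : ∀ {a b μ} → 0# ≤ μ → a Data.Nat.≤ b → ofℕ a * μ ≤ ofℕ b * μ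
  ofℕ-*-mono {b = zero}  0≤μ z≤n = ≤-refl
  ofℕ-*-mono {a} {suc b} {μ} 0≤μ a≤1+b with ℕP.m≤n⇒m<n∨m≡n a≤1+b
  ... | inj₂ refl = ≤-refl
  ... | inj₁ (s≤s a≤b) = ≤-trans (ofℕ-*-mono 0≤μ a≤b)
                           (subst (ofℕ b * μ ≤_) (sym (ofℕ-suc-* b μ)) (y≤x+y _ 0≤μ))

  ∑-bound : ∀ {n μ} (f : Fin n → Carrier) → (∀ j → f j ≤ μ) → ∑ f ≤ ofℕ n * μ
  ∑-bound {zero}  {μ} f f≤μ = ≤-reflexive (sym (zeroˡ μ))
  ∑-bound {suc n} {μ} f f≤μ =
    subst (∑ f ≤_) (sym (ofℕ-suc-* n μ))
          (+-mono (f≤μ zero) (∑-bound (λ i → f (suc i)) (λ i → f≤μ (suc i))))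

-- A Boolean relation ⟶ on Fin n with in- and out-degree at most
-- one and no cycle decomposes Fin n into disjoint chains.  We name each chain
-- by its first element `head j`, found by following predecessors n times,
-- and show that (i) an edge stays inside a chain and (ii) two elements of one
-- chain are connected by a path, in one direction or the other.

module Chains {n : ℕ} (r : Fin n → Fin n → Bool)
              (in-once  : ∀ j → AtMostOne (λ i → r i j))
              (out-once : ∀ i → AtMostOne (r i))
              (acyclic  : ∀ i → ¬ TransClosure (λ a b → T (r a b)) i i) where

  _⟶_ : Fin n → Fin n → Set
  a ⟶ b = T (r a b)

  predOf : ∀ j → Dec (∃ λ i → i ⟶ j) → Fin n
  predOf j (yes (i , _)) = i
  predOf j (no _)        = j

  pred : Fin n → Fin n
  pred j = predOf j (FinP.any? λ i → T? (r i j))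

  predOf-spec : ∀ j d → predOf j d ⟶ j ⊎ ((¬ ∃ λ i → i ⟶ j) × predOf j d ≡ j)
  predOf-spec j (yes (i , i⟶j)) = inj₁ i⟶j
  predOf-spec j (no none)       = inj₂ (none , refl)

  pred-spec : ∀ j → pred j ⟶ j ⊎ ((¬ ∃ λ i → i ⟶ j) × pred j ≡ j)
  pred-spec j = predOf-spec j (FinP.any? λ i → T? (r i j))

  pred-unique : ∀ {i j} → i ⟶ j → pred j ≡ i
  pred-unique {i} {j} i⟶j with pred-spec j
  ... | inj₁ p⟶j        = in-once j _ _ p⟶j i⟶j
  ... | inj₂ (none , _) = ⊥-elim (none (i , i⟶j))

  pred-moves : ∀ j → pred j ≢ j → pred j ⟶ j
  pred-moves j moved with pred-spec j
  ... | inj₁ p⟶j      = p⟶j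
  ... | inj₂ (_ , eq) = ⊥-elim (moved eq)

  up : ℕ → Fin n → Fin n
  up zero    j = j
  up (suc k) j = pred (up k j)

  up-suc : ∀ k j → up (suc k) j ≡ up k (pred j)
  up-suc zero    j = refl
  up-suc (suc k) j = cong pred (up-suc k j)

  up-path : ∀ k j → Star _⟶_ (up k j) j
  up-path zero    j = ε
  up-path (suc k) j with pred-spec (up k j)
  ... | inj₁ step      = step ◅ up-path k j
  ... | inj₂ (_ , eq)  = subst (λ z → Star _⟶_ z j) (sym eq) (up-path k j)

  Stationary : Fin n → Set
  Stationary a = pred a ≡ a

  stationary-later : ∀ o {c j} → Stationary (up c j) → Stationary (up (o Data.Nat.+ c) j)
  stationary-later zero    s = s
  stationary-later (suc o) s = cong pred (stationary-later o s)

  -- By acyclicity, following predecessors n times reaches a fixed point: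
  -- otherwise up 0 j, …, up n j would all move, and two of these n + 1
  -- elements of Fin n would coincide, closing a cycle.
  up-n-stationary : ∀ j → Stationary (up n j)
  up-n-stationary j with pred (up n j) ≟ up n j
  ... | yes s     = s
  ... | no moving with FinP.pigeonhole (ℕP.n<1+n n) (λ i → up (toℕ i) j)
  ...   | a , b , a<b , same = ⊥-elim $
    acyclic (up (toℕ b) j)
      (subst (λ z → TransClosure _⟶_ (up (toℕ b) j) z) same
             (descent (toℕ a) (toℕ b) a<b (s≤s⁻¹ (FinP.toℕ<n b))))
    where
    moving-before : ∀ c → c Data.Nat.≤ n → ¬ Stationary (up c j)
    moving-before c c≤n s =
      moving (subst (λ k → Stationary (up k j)) (ℕP.m∸n+n≡m c≤n) (stationary-later (n Data.Nat.∸ c) s))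

    descent : ∀ a b → a Data.Nat.< b → b Data.Nat.≤ n → TransClosure _⟶_ (up b j) (up a j)
    descent a (suc b) a<1+b 1+b≤n with ℕP.m≤n⇒m<n∨m≡n (s≤s⁻¹ a<1+b)
    ... | inj₂ refl = [ step ]
      where step = pred-moves (up a j) (moving-before a (ℕP.≤-trans (ℕP.n≤1+n a) 1+b≤n))
    ... | inj₁ a<b  = step ∷ descent a b a<b b≤n
      where
      b≤n = ℕP.≤-trans (ℕP.n≤1+n b) 1+b≤n
      step = pred-moves (up b j) (moving-before b b≤n)

  head : Fin n → Fin n
  head = up n

  head-path : ∀ j → Star _⟶_ (head j) j
  head-path = up-path n

  head-edge : ∀ {i j} → i ⟶ j → head i ≡ head j
  head-edge {i} {j} i⟶j = begin
    up n i          ≡⟨ cong (up n) (pred-unique i⟶j) ⟨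
    up n (pred j)   ≡⟨ up-suc n j ⟨
    pred (up n j)   ≡⟨ up-n-stationary j ⟩
    up n j          ∎
    where open ≡-Reasoning

  -- Out-degree at most one: two paths from a common start are nested.
  nested : ∀ {h a b} → Star _⟶_ h a → Star _⟶_ h b → Star _⟶_ a b ⊎ Star _⟶_ b a
  nested ε                q                = inj₁ q
  nested (step ◅ p)       ε                = inj₂ (step ◅ p)
  nested (step ◅ p)       (step′ ◅ q) with out-once _ _ _ step step′
  ... | refl = nested p q

  same-head : ∀ {a b} → head a ≡ head b → Star _⟶_ a b ⊎ Star _⟶_ b a
  same-head {a} {b} eq = nested (head-path a) (subst (λ h → Star _⟶_ h b) (sym eq) (head-path b))

-- The precedence/delay constraint of P₄ is the fourth factor of the product
-- `P4Feasible`; Defs phrases it through a conditional local to that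
-- definition, so we refer to it through the shape of the product.
FourthFactor : (S : Set) {A B C D R : Set} → S ≡ (A × B × C × D × R) → Set
FourthFactor _ {D = D} _ = D

module Directions (F : OrderedField) {n m : ℕ} (I : Instance F n m) (ρ : OrderedField.Carrier F) where
  open OrderedField F
  open Instance I
  open OrderedFieldFacts F
  open IsCommutativeRing isCommutativeRing using (+-identityʳ)

  EdgeConstraint : Carrier → (t d : Fin n → Carrier) → (Fin n → Fin n → Bool) → Set
  EdgeConstraint μ t d x = FourthFactor (P4Feasible F I ρ μ t d x) refl

  edge-constraint⁻ : ∀ {μ t d x} → EdgeConstraint μ t d x → ∀ i j → T (edge i j) →
                     (t i + d i ≤ t j) × (¬ T (x i j) → t i + d i + c i j ≤ t j)
  edge-constraint⁻ {x = x} h i j e with x i j | h i j e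
  ... | true  | h′ = subst (_≤ _) (+-identityʳ _) h′ , λ ¬x → ⊥-elim (¬x tt)
  ... | false | h′ = ≤-trans (x≤x+y _ (c-nonneg i j e)) h′ , λ _ → h′

  edge-constraint⁺ : ∀ {μ t d x} →
                     (∀ i j → T (edge i j) → t i + d i ≤ t j) →
                     (∀ i j → T (edge i j) → ¬ T (x i j) → t i + d i + c i j ≤ t j) →
                     EdgeConstraint μ t d x
  edge-constraint⁺ {x = x} prec delay i j e with x i j in xij
  ... | true  = subst (_≤ _) (sym (+-identityʳ _)) (prec i j e)
  ... | false = delay i j e (subst T xij)

  delayed : Schedule F I ρ → Carrier → Schedule F I ρ
  delayed S s = record S { t = λ j → Schedule.t S j + s }

  delayed-feasible : ∀ S {s} → 0# ≤ s → Feasible F I ρ S → Feasible F I ρ (delayed S s)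
  delayed-feasible S {s} 0≤s (t≥0 , d≥0 , prec , delay , disjoint , energy) =
    (λ j → +-nonneg (t≥0 j) 0≤s) , d≥0 , (λ i j e → shift-≤ s (prec i j e)) ,
    (λ i j e p≢ → shift-≤₂ s (delay i j e p≢)) ,
    (λ a b a≢b p≡ → Sum.map (shift-≤ s) (shift-≤ s) (disjoint a b a≢b p≡)) , energy

  P4Solution : Carrier → Set
  P4Solution μ = Σ (Fin n → Carrier) λ t → Σ (Fin n → Carrier) λ d →
                 Σ (Fin n → Fin n → Bool) λ x → P4Feasible F I ρ μ t d x

  GoodSchedule : Carrier → Set
  GoodSchedule μ = Σ (Schedule F I ρ) λ S →
                   Feasible F I ρ S × HasMakespan F I ρ S μ × DelayCond F I ρ (Schedule.d S)

  module Earliest = Extremum _≤_ total ≤-trans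
  module Latest   = Extremum (flip _≤_) (λ a b → Sum.swap (total a b)) (λ p q → ≤-trans q p)

  -- A feasible schedule finishing by μ can be delayed to finish exactly at μ
  -- (delay it by μ minus the latest completion time).
  finish-exactly : 1 Data.Nat.≤ n → ∀ S {μ} → Feasible F I ρ S →
                   (∀ j → Schedule.t S j + Schedule.d S j ≤ μ) →
                   ∃ λ s → Feasible F I ρ (delayed S s) × HasMakespan F I ρ (delayed S s) μ
  finish-exactly 1≤n S {μ} feasible finish with Latest.least (λ _ → true) (λ j → t j + d j)
    where open Schedule S
  ... | inj₁ none = ⊥-elim (none (fromℕ< 1≤n) tt)
  ... | inj₂ (k , _ , k-last) =
    μ - M , delayed-feasible S (≤⇒0≤- (finish k)) feasible ,
    (λ j → subst (t j + (μ - M) + d j ≤_) (x+[y-x]≡y M μ) (shift-≤ (μ - M) (k-last j tt))) ,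
    (k , trans (+-swapʳ (t k) (μ - M) (d k)) (x+[y-x]≡y M μ))
    where
    open Schedule S
    M = t k + d k

  module ChainOrder (t d : Fin n → Carrier) (d≥0 : ∀ j → 0# ≤ d j)
                    {_⟶_ : Fin n → Fin n → Set} (prec : ∀ {a b} → a ⟶ b → t a + d a ≤ t b) where

    path-start-≤ : ∀ {a b} → Star _⟶_ a b → t a ≤ t b
    path-start-≤ ε                    = ≤-refl
    path-start-≤ {a} (a⟶ ◅ path)      = ≤-trans (≤-trans (x≤x+y (t a) (d≥0 a)) (prec a⟶)) (path-start-≤ path)

    path-finish-≤ : ∀ {a b} → Star _⟶_ a b → a ≢ b → t a + d a ≤ t b
    path-finish-≤ ε             a≢a = ⊥-elim (a≢a refl)
    path-finish-≤ (a⟶ ◅ path)   _   = ≤-trans (prec a⟶) (path-start-≤ path)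

  module FromP4 (n≤m : n Data.Nat.≤ m) (μ : Carrier) (t d : Fin n → Carrier) (x : Fin n → Fin n → Bool)
                (d≥0 : ∀ j → 0# ≤ d j) (edges : EdgeConstraint μ t d x)
                (out-degree : ∀ i → count (λ j → edge i j ∧ x i j) Data.Nat.≤ 1)
                (in-degree  : ∀ j → count (λ i → edge i j ∧ x i j) Data.Nat.≤ 1) where

    selected : Fin n → Fin n → Bool
    selected i j = edge i j ∧ x i j

    selected-acyclic : ∀ i → ¬ TransClosure (λ a b → T (selected a b)) i i
    selected-acyclic i cycle =
      acyclic i (Equivalence.to equivalent (map {f = λ a → a} ∧-elimˡ (Equivalence.from equivalent cycle)))

    open Chains selected (λ j → count≤1⇒AtMostOne _ (in-degree j))
                         (λ i → count≤1⇒AtMostOne _ (out-degree i)) selected-acyclic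

    edge-facts : ∀ i j → T (edge i j) → (t i + d i ≤ t j) × (¬ T (x i j) → t i + d i + c i j ≤ t j)
    edge-facts = edge-constraint⁻ {μ} {t} {d} {x} edges

    precedence : ∀ i j → T (edge i j) → t i + d i ≤ t j
    precedence i j e = proj₁ (edge-facts i j e)

    open ChainOrder t d d≥0 {_⟶_} (λ {a} {b} a⟶b → precedence a b (∧-elimˡ {edge a b} a⟶b))

    schedule : Schedule F I ρ
    schedule = record { t = t ; d = d ; p = λ j → inject≤ (head j) n≤m }

    -- A cross-processor edge joins two chains, so it is unselected and
    -- P₄ charges its delay; tasks sharing a processor lie on one chain.
    schedule-feasible : (∀ j → 0# ≤ t j) → ∑ (λ j → e j (d j)) ≤ E → Feasible F I ρ schedule
    schedule-feasible t≥0 energy =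
      t≥0 , d≥0 , precedence ,
      (λ i j e p≢ → proj₂ (edge-facts i j e)
                      λ xij → p≢ (cong (λ h → inject≤ h n≤m) (head-edge (∧-intro e xij)))) ,
      (λ a b a≢b p≡ → Sum.map (λ path → path-finish-≤ path a≢b) (λ path → path-finish-≤ path (a≢b ∘ sym))
                              (same-head (FinP.inject≤-injective n≤m n≤m (head a) (head b) p≡))) ,
      energy

    good-schedule : 1 Data.Nat.≤ n → (∀ j → 0# ≤ t j) → ∑ (λ j → e j (d j)) ≤ E →
                    (∀ j → t j + d j ≤ μ) → DelayCond F I ρ d → GoodSchedule μ
    good-schedule 1≤n t≥0 energy finish delays
      with finish-exactly 1≤n schedule (schedule-feasible t≥0 energy) finish
    ... | s , feasible , makespan = delayed schedule s , feasible , makespan , delays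

  module FromSchedule (t d : Fin n → Carrier) (p : Fin n → Fin m)
                      (prec   : ∀ i j → T (edge i j) → t i + d i ≤ t j)
                      (across : ∀ i j → T (edge i j) → p i ≢ p j → t i + d i + c i j ≤ t j)
                      (disjoint : ∀ a b → a ≢ b → p a ≡ p b → (t a + d a ≤ t b) ⊎ (t b + d b ≤ t a))
                      (c≤d : ∀ i j k → T (edge i j) → c i j ≤ d k) where

    local : Fin n → Fin n → Bool
    local i j = edge i j ∧ isYes (p i ≟ p j)

    local-intro : ∀ {i j} → T (edge i j) → p i ≡ p j → T (local i j)
    local-intro e p≡ = ∧-intro e (fromWitness p≡)

    local-proc : ∀ {i j} → T (local i j) → p i ≡ p j
    local-proc {i} {j} l = toWitness (∧-elimʳ {edge i j} l)

    next : ∀ i → Earliest.Search (local i) t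
    next i = Earliest.least (local i) t

    prev : ∀ j → Latest.Search (λ i → local i j) (λ i → t i + d i)
    prev j = Latest.least (λ i → local i j) (λ i → t i + d i)

    x : Fin n → Fin n → Bool
    x i j = Earliest.chosen (next i) j ∧ Latest.chosen (prev j) i

    out-degree : ∀ i → count (λ j → edge i j ∧ x i j) Data.Nat.≤ 1
    out-degree i = AtMostOne⇒count≤1 _ λ a b sa sb →
      Earliest.chosen-once (next i) a b (is-next (∧-elimʳ {edge i a} sa)) (is-next (∧-elimʳ {edge i b} sb))
      where
      is-next : ∀ {j} → T (x i j) → T (Earliest.chosen (next i) j)
      is-next {j} = ∧-elimˡ {Earliest.chosen (next i) j}

    in-degree : ∀ j → count (λ i → edge i j ∧ x i j) Data.Nat.≤ 1
    in-degree j = AtMostOne⇒count≤1 _ λ a b sa sb →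
      Latest.chosen-once (prev j) a b (is-prev (∧-elimʳ {edge a j} sa)) (is-prev (∧-elimʳ {edge b j} sb))
      where
      is-prev : ∀ {i} → T (x i j) → T (Latest.chosen (prev j) i)
      is-prev {i} = ∧-elimʳ {Earliest.chosen (next i) j}

    -- A successor k of i on j's processor, starting no later than j, lies
    -- between i and j and pays for the delay.
    delay-via-successor : ∀ {i j k} → T (edge i j) → T (edge i k) → k ≢ j → p k ≡ p j →
                          t k ≤ t j → t i + d i + c i j ≤ t j
    delay-via-successor {i} {j} {k} eij eik k≢j pk≡pj tk≤tj with disjoint k j k≢j pk≡pj
    ... | inj₁ k-first = ≤-trans (+-mono (prec i k eik) (c≤d i j k eij)) k-first
    ... | inj₂ j-first = ≤-trans (+-mono (prec i j eij) (c≤d i j j eij)) (≤-trans j-first tk≤tj)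

    -- A predecessor k of j on i's processor, finishing no earlier than i,
    -- lies between i and j and pays for the delay.
    delay-via-predecessor : ∀ {i j k} → T (edge i j) → T (edge k j) → k ≢ i → p i ≡ p k →
                            t i + d i ≤ t k + d k → t i + d i + c i j ≤ t j
    delay-via-predecessor {i} {j} {k} eij ekj k≢i pi≡pk fi≤fk with disjoint i k (k≢i ∘ sym) pi≡pk
    ... | inj₁ i-first = ≤-trans (+-mono i-first (c≤d i j k eij)) (prec k j ekj)
    ... | inj₂ k-first = ≤-trans (+-monoʳ-≤ (t i + d i) (c≤d i j i eij))
                           (≤-trans (+-mono-≤ (d i) (≤-trans fi≤fk k-first)) (prec i j eij))

    unselected-delay : ∀ i j → T (edge i j) → ¬ T (x i j) → t i + d i + c i j ≤ t j
    unselected-delay i j e ¬x with p i ≟ p j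
    ... | no p≢ = across i j e p≢
    ... | yes p≡ with ∧-false (Earliest.chosen (next i) j) ¬x
    ...   | inj₁ ¬next with Earliest.not-chosen (next i) (local-intro e p≡) ¬next
    ...     | k , k≢j , l , tk≤tj = delay-via-successor e (∧-elimˡ l) k≢j (trans (sym (local-proc l)) p≡) tk≤tj
    unselected-delay i j e ¬x | yes p≡ | inj₂ ¬prev with Latest.not-chosen (prev j) (local-intro e p≡) ¬prev
    ...     | k , k≢i , l , fi≤fk = delay-via-predecessor e (∧-elimˡ l) k≢i (trans p≡ (sym (local-proc l))) fi≤fk

    edges : ∀ μ → EdgeConstraint μ t d x
    edges μ = edge-constraint⁺ {μ} {t} {d} {x} prec unselected-delay

  P4⇒schedule : 1 Data.Nat.≤ n → n Data.Nat.≤ m → ∀ μ → P4Solution μ → GoodSchedule μ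
  P4⇒schedule 1≤n n≤m μ (t , d , x , _ , t≥0 , d≥0 , edges , out , in′ , finish , energy , delays , _) =
    FromP4.good-schedule n≤m μ t d x d≥0 edges out in′ 1≤n t≥0 energy finish delays

  schedule⇒P4 : n Data.Nat.≤ m → 1# ≤ ρ → ∀ μ → 0# ≤ μ → GoodSchedule μ → P4Solution μ
  schedule⇒P4 n≤m 1≤ρ μ 0≤μ (S , (t≥0 , d≥0 , prec , across , disjoint , energy) , (finish , _) , delays) =
    t , d , x , 0≤μ , t≥0 , d≥0 , edges μ , out-degree , in-degree , finish , energy , delays , load
    where
    open Schedule S
    -- ρ ≥ 1 turns the delay condition ρ·c_ij ≤ d_k into c_ij ≤ d_k
    open FromSchedule t d p prec across disjoint
                      (λ i j k e → ≤-trans (≤ρ* (c-nonneg i j e) 1≤ρ) (delays i j k e))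
    -- every task lies within [0, μ], so Σ_j d_j ≤ n·μ ≤ m·μ
    load : ∑ d ≤ ofℕ m * μ
    load = ≤-trans (∑-bound d λ j → ≤-trans (y≤x+y (d j) (t≥0 j)) (finish j)) (ofℕ-*-mono 0≤μ n≤m)

open OrderedField using (Carrier; _≤_; 0#; 1#)

lemma3 : (F : OrderedField) (n m : ℕ) → 1 Data.Nat.≤ n → n Data.Nat.≤ m →
    (I : Instance F n m) (ρ : Carrier F) → _≤_ F (1# F) ρ →
    (μ : Carrier F) → _≤_ F (0# F) μ →
    (Σ (Fin n → Carrier F) λ t → Σ (Fin n → Carrier F) λ d →
       Σ (Fin n → Fin n → Bool) λ x → P4Feasible F I ρ μ t d x)
    ⇔
    (Σ (Schedule F I ρ) λ S →
       Feasible F I ρ S × HasMakespan F I ρ S μ × DelayCond F I ρ (Schedule.d S))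
lemma3 F n m 1≤n n≤m I ρ 1≤ρ μ 0≤μ =
  mk⇔ (P4⇒schedule 1≤n n≤m μ) (schedule⇒P4 n≤m 1≤ρ μ 0≤μ)
  where open Directions F I ρ
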